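{- Let $S=(S^-,\mathcal{F})$, $T=(T^-,\mathcal{F})$ be causal multiteams of signature $\sigma$ that are rescalings of each other, let $\varphi\in\mathcal{PCO}^{\omega}_{\sigma}$, and suppose $S\models \varphi$. Then $T\models \varphi$.
   Context: A causal multiteam $T=(T^-,\mathcal{F})$ of signature $\sigma$ consists of a finite multiset $T^-$ of assignments and a recursive function component $\mathcal{F}$ of structural equations compatible with every row. For an assignment $t$, $\#(t,T)$ is the number of copies of $t$ in $T^-$ and $\epsilon^T_t=\#(t,T)/|T^-|$; $S$ and $T$ are rescalings of each other if they have the same function component and either $S^-=T^-=\emptyset$ or $\epsilon^S_t=\epsilon^T_t$ for all assignments $t$. $\mathcal{CO}$: $\alpha ::= Y=y \mid Y\neq y \mid \alpha\land\alpha \mid \alpha\lor\alpha \mid \alpha\supset\alpha \mid \mathbf X=\mathbf x \mathrel{\Box\!\!\rightarrow} \alpha$, where $\mathrel{\Box\!\!\rightarrow}$ is the interventionist counterfactual ($T\models\mathbf X=\mathbf x\mathrel{\Box\!\!\rightarrow}\psi$ iff the intervened multiteam $T_{\mathbf X=\mathbf x}$ satisfies $\psi$, or $\mathbf X=\mathbf x$ is inconsistent) and $T\models\alpha\supset\psi$ iff $T^\alpha\models\psi$, with $T^\alpha$ the sub-multiteam of rows $s$ with $(\{s\},\mathcal{F})\models\alpha$. $\mathcal{PCO}$: $\varphi ::= \eta \mid \varphi\land\varphi \mid \varphi\sqcup\varphi \mid \alpha\supset\varphi \mid \mathbf X=\mathbf x\mathrel{\Box\!\!\rightarrow}\varphi$,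 atoms being literals or $\Pr(\alpha)\geq\epsilon$, $\Pr(\alpha)>\epsilon$, $\Pr(\alpha)\geq\Pr(\beta)$, $\Pr(\alpha)>\Pr(\beta)$, which hold iff $T$ is empty or the inequality holds for $P_T(\alpha)=|(T^\alpha)^-|/|T^-|$; $\sqcup$ is Boolean disjunction. $\mathcal{PCO}^\omega$ additionally allows countably infinite global disjunctions $\bigsqcup_{i\in I}\psi_i$. -}

module Defs where

open import Data.Nat as ℕ using (ℕ; zero; suc; _<_)
open import Data.Fin as Fin using (Fin; toℕ)
open import Data.Fin.Properties as FinP using (all?)
open import Data.Fin.Subset using (Subset; _∈_)
open import Data.Bool using (Bool; true; false; not; _∧_; _∨_; if_then_else_)
open import Data.List using (List; []; _∷_; length; foldr; map)
open import Data.Bool.ListAction using (any; all)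
open import Data.List.Relation.Unary.All using (All)
open import Data.Maybe using (Maybe; just; nothing; maybe)
open import Data.Product using (Σ; _×_; _,_; proj₁; proj₂)
open import Data.Sum using (_⊎_)
open import Data.Integer using (+_)
open import Data.Rational as ℚ using (ℚ; 0ℚ; 1ℚ)
open import Relation.Nullary using (Dec; yes; no; ⌊_⌋; ¬_)
open import Relation.Binary.PropositionalEquality using (_≡_; _≢_; refl)

record Signature : Set where
  field
    n       : ℕ
    rng     : Fin n → ℕ
    rng-pos : ∀ V → 0 < rng V
open Signature public

Var : Signature → Set
Var σ = Fin (n σ)

Val : (σ : Signature) → Var σ → Set
Val σ V = Fin (rng σ V)

module _ (σ : Signature) where

  Assignment : Set
  Assignment = (V : Var σ) → Val σ V

  update : Assignment → (V : Var σ) → Val σ V → Assignment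
  update s V v W with W Fin.≟ V
  ... | yes refl = v
  ... | no _ = s W

  _≟A_ : (s t : Assignment) → Dec (∀ V → s V ≡ t V)
  s ≟A t = all? (λ V → s V Fin.≟ t V)

  record Equation (V : Var σ) : Set where
    field
      pa    : Subset (n σ)
      fn    : Assignment → Val σ V
      local : ∀ s t → (∀ W → W ∈ pa → s W ≡ t W) → fn s ≡ fn t
  open Equation public

  -- A function component: for each variable, either an equation
  -- (V endogenous) or nothing (V exogenous).
  FunComp : Set
  FunComp = (V : Var σ) → Maybe (Equation V)

  -- Recursive = the causal graph (W → V iff W ∈ PA_V) is acyclic,
  -- expressed by the existence of a strict ranking of the variables.
  Recursive : FunComp → Set
  Recursive F =
    Σ (Var σ → ℕ) λ rank →
      ∀ V e W → F V ≡ just e → W ∈ pa e → rank W < rank V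

  Compatible : FunComp → Assignment → Set
  Compatible F s = ∀ V e → F V ≡ just e → s V ≡ fn e s

  Intervention : Set
  Intervention = List (Σ (Var σ) (Val σ))

  consistent : Intervention → Bool
  consistent X =
    all (λ a → all (λ b → not ⌊ proj₁ a Fin.≟ proj₁ b ⌋
                          ∨ ⌊ toℕ (proj₂ a) ℕ.≟ toℕ (proj₂ b) ⌋) X) X

  inX : Var σ → Intervention → Bool
  inX V X = any (λ a → ⌊ proj₁ a Fin.≟ V ⌋) X

  _after_ : FunComp → Intervention → FunComp
  (F after X) V = if inX V X then nothing else F V

  setAll : Intervention → Assignment → Assignment
  setAll X s = foldr (λ a t → update t (proj₁ a) (proj₂ a)) s X

  step : FunComp → Assignment → Assignment
  step F s V = maybe (λ e → fn e s) (s V) (F V)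

  iter : {A : Set} → ℕ → (A → A) → A → A
  iter zero f a = a
  iter (suc k) f a = f (iter k f a)

  -- s_{X=x}: set X to x, then recompute the endogenous variables of
  -- F_{X=x} along the (acyclic) causal graph; n rounds suffice since
  -- every causal path has fewer than n edges.
  intervene : FunComp → Intervention → Assignment → Assignment
  intervene F X s = iter (n σ) (step (F after X)) (setAll X s)

  data CO : Set where
    _≐_    : (Y : Var σ) → Val σ Y → CO
    _≠_    : (Y : Var σ) → Val σ Y → CO
    _∧CO_  : CO → CO → CO
    _∨CO_  : CO → CO → CO
    _⊃CO_  : CO → CO → CO
    _□→CO_ : Intervention → CO → CO

  -- holds F s α  ⇔  ({s}, F) ⊨ α
  holds : FunComp → Assignment → CO → Bool
  holds F s (Y ≐ y) = ⌊ s Y Fin.≟ y ⌋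
  holds F s (Y ≠ y) = not ⌊ s Y Fin.≟ y ⌋
  holds F s (α ∧CO β) = holds F s α ∧ holds F s β
  holds F s (α ∨CO β) = holds F s α ∨ holds F s β
  holds F s (α ⊃CO β) = not (holds F s α) ∨ holds F s β
  holds F s (X □→CO β) =
    if consistent X then holds (F after X) (intervene F X s) β else true

  filterᵇ : {A : Set} → (A → Bool) → List A → List A
  filterᵇ p [] = []
  filterᵇ p (x ∷ xs) = if p x then x ∷ filterᵇ p xs else filterᵇ p xs

  -- k / m as a rational (0 when m = 0; only used for nonempty teams)
  ratio : ℕ → ℕ → ℚ
  ratio k zero = 0ℚ
  ratio k (suc m) = (+ k) ℚ./ suc m

  restrict : FunComp → List (Assignment) → CO → List (Assignment)
  restrict F T α = filterᵇ (λ s → holds F s α) T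

  Pr : FunComp → List (Assignment) → CO → ℚ
  Pr F T α = ratio (length (restrict F T α)) (length T)

  count : Assignment → List (Assignment) → ℕ
  count t T = length (filterᵇ (λ s → ⌊ s ≟A t ⌋) T)

  eps : Assignment → List (Assignment) → ℚ
  eps t T = ratio (count t T) (length T)

  Rescaling : List (Assignment) → List (Assignment) → Set
  Rescaling S T = (length S ≡ 0 × length T ≡ 0) ⊎ (∀ t → eps t S ≡ eps t T)

  data PCO : Set where
    lit≐   : (Y : Var σ) → Val σ Y → PCO
    lit≠   : (Y : Var σ) → Val σ Y → PCO
    Pr≥    : CO → (ε : ℚ) → 0ℚ ℚ.≤ ε → ε ℚ.≤ 1ℚ → PCO
    Pr>    : CO → (ε : ℚ) → 0ℚ ℚ.≤ ε → ε ℚ.≤ 1ℚ → PCO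
    Pr≥Pr  : CO → CO → PCO
    Pr>Pr  : CO → CO → PCO
    _∧P_   : PCO → PCO → PCO
    _⊔_    : PCO → PCO → PCO
    ⨆      : (ℕ → PCO) → PCO
    _⊃P_   : CO → PCO → PCO
    _□→P_  : Intervention → PCO → PCO

  sat : FunComp → List (Assignment) → PCO → Set
  sat F T (lit≐ Y y) = All (λ s → s Y ≡ y) T
  sat F T (lit≠ Y y) = All (λ s → s Y ≢ y) T
  sat F T (Pr≥ α ε _ _) = length T ≡ 0 ⊎ ε ℚ.≤ Pr F T α
  sat F T (Pr> α ε _ _) = length T ≡ 0 ⊎ ε ℚ.< Pr F T α
  sat F T (Pr≥Pr α β) = length T ≡ 0 ⊎ Pr F T β ℚ.≤ Pr F T α
  sat F T (Pr>Pr α β) = length T ≡ 0 ⊎ Pr F T β ℚ.< Pr F T α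
  sat F T (φ ∧P ψ) = (sat F T φ) × (sat F T ψ)
  sat F T (φ ⊔ ψ) = (sat F T φ) ⊎ (sat F T ψ)
  sat F T (⨆ φs) = Σ ℕ λ i → sat F T (φs i)
  sat F T (α ⊃P ψ) = sat F (restrict F T α) ψ
  sat F T (X □→P ψ) = consistent X ≡ false ⊎ (sat (F after X) (map (intervene F X) T) ψ)

_,_⊨_ : {σ : Signature} → FunComp σ → List (Assignment σ) → PCO σ → Set
_,_⊨_ {σ} = sat σ

module Submission where

-- Satisfaction of a PCO formula only ever inspects a multiteam through the
-- relative frequencies of sets of rows (probability atoms), through "every
-- row satisfies" (literals), and through the multiteams obtained by
-- filtering or by mapping an intervention over the rows.  Call S and T
-- proportional if a·#p(S) = b·#p(T) for fixed positive weights a, b and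
-- every predicate p on rows: this determines all three kinds of
-- information and is preserved by filtering and mapping, so satisfaction
-- transfers by induction on the formula.  Rescaling gives the equation for
-- the predicates "equal to u", and every predicate is a disjoint union of
-- such classes.

open import Defs
open import Data.Bool using (Bool; true; false; not; _∧_; _∨_; if_then_else_)
import Data.Bool as Bool
open import Data.Bool.Properties using (∧-zeroʳ; ∧-comm)
open import Data.Empty using (⊥-elim)
import Data.Fin as Fin
import Data.Integer as ℤ
open import Data.Integer.Properties using (pos-*)
open import Data.List using (List; []; _∷_; length; map)
open import Data.Maybe using (just; nothing)
open import Data.List.Relation.Unary.All as All using (All; []; _∷_)
open import Data.Nat using (ℕ; zero; suc; _+_; _*_; _≤_; s≤s)
open import Data.Nat.Properties
open import Data.Product using (_,_)
open import Data.Rational as ℚ using (0ℚ)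
open import Data.Rational.Properties using (fromℚᵘ-cong; normalize-injective-≃)
open import Data.Rational.Unnormalised using (mkℚᵘ; *≡*)
open import Data.Sum using (inj₁; inj₂) renaming (map to ⊎-map)
open import Data.Unit using (tt)
open import Function using (id; _∘_)
open import Relation.Nullary using (Dec; yes; no; ⌊_⌋; ¬?)
open import Relation.Nullary.Decidable using (toWitness; fromWitness)
open import Relation.Binary.PropositionalEquality
open import Algebra.Properties.CommutativeSemigroup *-commutativeSemigroup
  using (x∙yz≈y∙xz; x∙yz≈yx∙z)

cross-multiply : ∀ a b {x y m k} → suc a * x ≡ suc b * y → suc a * m ≡ suc b * k →
                 x * k ≡ y * m
cross-multiply a b {x} {y} {m} {k} ax≡by am≡bk =
  *-cancelˡ-≡ (x * k) (y * m) (suc a) (begin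
    suc a * (x * k)    ≡⟨ cong (suc a *_) (*-comm x k) ⟩
    suc a * (k * x)    ≡⟨ x∙yz≈y∙xz (suc a) k x ⟩
    k * (suc a * x)    ≡⟨ cong (k *_) ax≡by ⟩
    k * (suc b * y)    ≡⟨ x∙yz≈yx∙z k (suc b) y ⟩
    (suc b * k) * y    ≡⟨ cong (_* y) am≡bk ⟨
    (suc a * m) * y    ≡⟨ *-assoc (suc a) m y ⟩
    suc a * (m * y)    ≡⟨ cong (suc a *_) (*-comm m y) ⟩
    suc a * (y * m)    ∎)
  where open ≡-Reasoning

module _ (σ : Signature) {A : Set} where

  filterᵇ-cong : ∀ {p q : A → Bool} → (∀ x → p x ≡ q x) → ∀ L →
                 filterᵇ σ p L ≡ filterᵇ σ q L
  filterᵇ-cong p≗q [] = refl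
  filterᵇ-cong {p} {q} p≗q (x ∷ L) rewrite p≗q x =
    cong (λ L′ → if q x then x ∷ L′ else L′) (filterᵇ-cong p≗q L)

  filterᵇ-filterᵇ : ∀ (p q : A → Bool) L →
                    filterᵇ σ p (filterᵇ σ q L) ≡ filterᵇ σ (λ x → q x ∧ p x) L
  filterᵇ-filterᵇ p q [] = refl
  filterᵇ-filterᵇ p q (x ∷ L) with q x
  ... | false = filterᵇ-filterᵇ p q L
  ... | true with p x
  ...   | true  = cong (x ∷_) (filterᵇ-filterᵇ p q L)
  ...   | false = filterᵇ-filterᵇ p q L

  filterᵇ-comm : ∀ (p q : A → Bool) L →
                 filterᵇ σ p (filterᵇ σ q L) ≡ filterᵇ σ q (filterᵇ σ p L)
  filterᵇ-comm p q L = begin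
    filterᵇ σ p (filterᵇ σ q L)       ≡⟨ filterᵇ-filterᵇ p q L ⟩
    filterᵇ σ (λ x → q x ∧ p x) L     ≡⟨ filterᵇ-cong (λ x → ∧-comm (q x) (p x)) L ⟩
    filterᵇ σ (λ x → p x ∧ q x) L     ≡⟨ filterᵇ-filterᵇ q p L ⟨
    filterᵇ σ q (filterᵇ σ p L)       ∎
    where open ≡-Reasoning

  filterᵇ-none : ∀ (L : List A) → filterᵇ σ (λ _ → false) L ≡ []
  filterᵇ-none [] = refl
  filterᵇ-none (x ∷ L) = filterᵇ-none L

  filterᵇ-all : ∀ (p : A → Bool) {L} → All (λ x → Bool.T (p x)) L → filterᵇ σ p L ≡ L
  filterᵇ-all p [] = refl
  filterᵇ-all p {x ∷ L} (px ∷ pL) with p x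
  ... | true  = cong (x ∷_) (filterᵇ-all p pL)
  ... | false = ⊥-elim px

  length-filterᵇ≤ : ∀ (p : A → Bool) L → length (filterᵇ σ p L) ≤ length L
  length-filterᵇ≤ p [] = ≤-refl
  length-filterᵇ≤ p (x ∷ L) with p x
  ... | true  = s≤s (length-filterᵇ≤ p L)
  ... | false = m≤n⇒m≤1+n (length-filterᵇ≤ p L)

  length-filterᵇ≡⇒All : ∀ (p : A → Bool) L →
                        length (filterᵇ σ p L) ≡ length L → All (λ x → Bool.T (p x)) L
  length-filterᵇ≡⇒All p [] _ = []
  length-filterᵇ≡⇒All p (x ∷ L) eq with p x in px
  ... | true  = subst Bool.T (sym px) tt ∷ length-filterᵇ≡⇒All p L (suc-injective eq)
  ... | false = ⊥-elim (<⇒≢ (s≤s (length-filterᵇ≤ p L)) eq)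

  length-partitionᵇ : ∀ (q : A → Bool) L →
                      length L ≡ length (filterᵇ σ q L) + length (filterᵇ σ (not ∘ q) L)
  length-partitionᵇ q [] = refl
  length-partitionᵇ q (x ∷ L) with q x
  ... | true  = cong suc (length-partitionᵇ q L)
  ... | false = trans (cong suc (length-partitionᵇ q L)) (sym (+-suc _ _))

  length-filterᵇ-map : ∀ {B : Set} (p : A → Bool) (f : B → A) L →
                       length (filterᵇ σ p (map f L)) ≡ length (filterᵇ σ (p ∘ f) L)
  length-filterᵇ-map p f [] = refl
  length-filterᵇ-map p f (x ∷ L) with p (f x)
  ... | true  = cong suc (length-filterᵇ-map p f L)
  ... | false = length-filterᵇ-map p f L

module _ (σ : Signature) where

  private
    Row : Set
    Row = Assignment σ

  -- Rows are functions, so every predicate on rows must be shown to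
  -- respect pointwise equality.
  _≈_ : Row → Row → Set
  s ≈ t = ∀ V → s V ≡ t V

  Extensional : (Row → Bool) → Set
  Extensional p = ∀ {s t} → s ≈ t → p s ≡ p t

  update-ext : ∀ {s t} → s ≈ t → ∀ V v → update σ s V v ≈ update σ t V v
  update-ext s≈t V v W with W Fin.≟ V
  ... | yes refl = refl
  ... | no _     = s≈t W

  setAll-ext : ∀ X {s t} → s ≈ t → setAll σ X s ≈ setAll σ X t
  setAll-ext []            s≈t = s≈t
  setAll-ext ((V , v) ∷ X) s≈t = update-ext (setAll-ext X s≈t) V v

  step-ext : ∀ F {s t} → s ≈ t → step σ F s ≈ step σ F t
  step-ext F {s} {t} s≈t V with F V
  ... | just e  = local e s t (λ W _ → s≈t W)
  ... | nothing = s≈t V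

  iter-step-ext : ∀ F k {s t} → s ≈ t → iter σ k (step σ F) s ≈ iter σ k (step σ F) t
  iter-step-ext F zero    s≈t = s≈t
  iter-step-ext F (suc k) s≈t = step-ext F (iter-step-ext F k s≈t)

  intervene-ext : ∀ F X {s t} → s ≈ t → intervene σ F X s ≈ intervene σ F X t
  intervene-ext F X s≈t = iter-step-ext (_after_ σ F X) (n σ) (setAll-ext X s≈t)

  holds-ext : ∀ F α → Extensional (λ s → holds σ F s α)
  holds-ext F (Y ≐ y)    s≈t = cong (λ v → ⌊ v Fin.≟ y ⌋) (s≈t Y)
  holds-ext F (Y ≠ y)    s≈t = cong (λ v → not ⌊ v Fin.≟ y ⌋) (s≈t Y)
  holds-ext F (α ∧CO β)  s≈t = cong₂ _∧_ (holds-ext F α s≈t) (holds-ext F β s≈t)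
  holds-ext F (α ∨CO β)  s≈t = cong₂ _∨_ (holds-ext F α s≈t) (holds-ext F β s≈t)
  holds-ext F (α ⊃CO β)  s≈t = cong₂ _∨_ (cong not (holds-ext F α s≈t)) (holds-ext F β s≈t)
  holds-ext F (X □→CO β) s≈t with consistent σ X
  ... | true  = holds-ext (_after_ σ F X) β (intervene-ext F X s≈t)
  ... | false = refl

  countᵇ : (Row → Bool) → List Row → ℕ
  countᵇ p L = length (filterᵇ σ p L)

  sameAs : Row → Row → Bool
  sameAs t s = ⌊ _≟A_ σ s t ⌋

  sameAs-refl : ∀ t → sameAs t t ≡ true
  sameAs-refl t with _≟A_ σ t t
  ... | yes _  = refl
  ... | no t≉t = ⊥-elim (t≉t (λ _ → refl))

  sameAs-ext : ∀ u → Extensional (sameAs u)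
  sameAs-ext u {s} {t} s≈t with _≟A_ σ s u | _≟A_ σ t u
  ... | yes _   | yes _   = refl
  ... | no _    | no _    = refl
  ... | yes s≈u | no t≉u  = ⊥-elim (t≉u (λ V → trans (sym (s≈t V)) (s≈u V)))
  ... | no s≉u  | yes t≈u = ⊥-elim (s≉u (λ V → trans (s≈t V) (t≈u V)))

  countᵇ-self : ∀ t L → countᵇ (sameAs t) (t ∷ L) ≡ suc (countᵇ (sameAs t) L)
  countᵇ-self t L rewrite sameAs-refl t = refl

  ∧-sameAs : ∀ {p} → Extensional p → ∀ u s → p s ∧ sameAs u s ≡ p u ∧ sameAs u s
  ∧-sameAs {p} p-ext u s with _≟A_ σ s u
  ... | yes s≈u = cong (_∧ true) (p-ext s≈u)
  ... | no _    = trans (∧-zeroʳ (p s)) (sym (∧-zeroʳ (p u)))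

  countᵇ-sameAs-filterᵇ : ∀ {q} → Extensional q → ∀ u L →
    countᵇ (sameAs u) (filterᵇ σ q L) ≡ countᵇ (λ s → q u ∧ sameAs u s) L
  countᵇ-sameAs-filterᵇ {q} q-ext u L =
    cong length (trans (filterᵇ-filterᵇ σ (sameAs u) q L) (filterᵇ-cong σ (∧-sameAs q-ext u) L))

  record Balanced (a b : ℕ) (S T : List Row) : Set where
    constructor balanced
    field balance : ∀ p → Extensional p → a * countᵇ p S ≡ b * countᵇ p T
  open Balanced

  record ClasswiseBalanced (a b : ℕ) (S T : List Row) : Set where
    constructor classwise
    field classBalance : ∀ u → a * countᵇ (sameAs u) S ≡ b * countᵇ (sameAs u) T
  open ClasswiseBalanced

  classwiseBalanced-filterᵇ : ∀ {a b S T q} → ClasswiseBalanced a b S T → Extensional q →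
    ClasswiseBalanced a b (filterᵇ σ q S) (filterᵇ σ q T)
  classwiseBalanced-filterᵇ {a} {b} {S} {T} {q} bal q-ext .classBalance u
    rewrite countᵇ-sameAs-filterᵇ q-ext u S | countᵇ-sameAs-filterᵇ q-ext u T with q u
  ... | true  = classBalance bal u
  ... | false rewrite filterᵇ-none σ S | filterᵇ-none σ T = trans (*-zeroʳ a) (sym (*-zeroʳ b))

  countᵇ-split : ∀ q p L →
    countᵇ p L ≡ countᵇ q (filterᵇ σ p L) + countᵇ p (filterᵇ σ (not ∘ q) L)
  countᵇ-split q p L =
    trans (length-partitionᵇ σ q (filterᵇ σ p L))
          (cong (countᵇ q (filterᵇ σ p L) +_) (cong length (filterᵇ-comm σ (not ∘ q) p L)))

  -- Split off the class of the first row of S: its count is balanced by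
  -- hypothesis, and the rows outside it form a shorter, again classwise
  -- balanced pair.
  classwise⇒balanced : ∀ k {a b S T} → length S ≤ k →
                       ClasswiseBalanced a b S T → Balanced a b S T
  classwise⇒balanced _ {a} {b} {[]} {[]} _ _ .balance _ _ = trans (*-zeroʳ a) (sym (*-zeroʳ b))
  classwise⇒balanced _ {a} {b} {[]} {t ∷ T} _ bal .balance p _ =
    trans (*-zeroʳ a) (cong (_* countᵇ p (t ∷ T)) (sym b≡0))
    where
    b≡0 : b ≡ 0
    b≡0 = m*n≡0⇒m≡0 b (suc (countᵇ (sameAs t) T))
            (trans (cong (b *_) (sym (countᵇ-self t T)))
                   (trans (sym (classBalance bal t)) (*-zeroʳ a)))
  classwise⇒balanced (suc k) {a} {b} {u ∷ S} {T} (s≤s |S|≤k) bal .balance p p-ext = begin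
    a * countᵇ p (u ∷ S)
      ≡⟨ cong (a *_) (countᵇ-split (sameAs u) p (u ∷ S)) ⟩
    a * (countᵇ (sameAs u) (filterᵇ σ p (u ∷ S)) + countᵇ p (outside (u ∷ S)))
      ≡⟨ *-distribˡ-+ a _ _ ⟩
    a * countᵇ (sameAs u) (filterᵇ σ p (u ∷ S)) + a * countᵇ p (outside (u ∷ S))
      ≡⟨ cong₂ _+_ (classBalance (classwiseBalanced-filterᵇ bal p-ext) u)
                   (balance (classwise⇒balanced k shrinks
                               (classwiseBalanced-filterᵇ bal outside-ext)) p p-ext) ⟩
    b * countᵇ (sameAs u) (filterᵇ σ p T) + b * countᵇ p (outside T)
      ≡⟨ *-distribˡ-+ b _ _ ⟨
    b * (countᵇ (sameAs u) (filterᵇ σ p T) + countᵇ p (outside T))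
      ≡⟨ cong (b *_) (countᵇ-split (sameAs u) p T) ⟨
    b * countᵇ p T
      ∎
    where
    open ≡-Reasoning
    outside : List Row → List Row
    outside = filterᵇ σ (not ∘ sameAs u)
    outside-ext : Extensional (not ∘ sameAs u)
    outside-ext s≈t = cong not (sameAs-ext u s≈t)
    shrinks : length (outside (u ∷ S)) ≤ k
    shrinks rewrite sameAs-refl u = ≤-trans (length-filterᵇ≤ σ (not ∘ sameAs u) S) |S|≤k

  balanced-length : ∀ {a b S T} → Balanced a b S T → a * length S ≡ b * length T
  balanced-length {a} {b} {S} {T} bal =
    subst₂ (λ m n → a * m ≡ b * n) (count-all S) (count-all T)
           (balance bal (λ _ → true) (λ _ → refl))
    where
    count-all : ∀ L → countᵇ (λ _ → true) L ≡ length L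
    count-all L = cong length (filterᵇ-all σ (λ _ → true) (All.universal (λ _ → tt) L))

  record Proportional (S T : List Row) : Set where
    constructor proportional
    field
      a b      : ℕ
      weighted : Balanced (suc a) (suc b) S T

  proportional-sym : ∀ {S T} → Proportional S T → Proportional T S
  proportional-sym (proportional a b bal) =
    proportional b a (balanced λ p p-ext → sym (balance bal p p-ext))

  proportional-length-zero : ∀ {S T} → Proportional S T → length S ≡ 0 → length T ≡ 0
  proportional-length-zero {S} {T} (proportional a b bal) |S|≡0 =
    m+n≡0⇒m≡0 (length T) (begin
      suc b * length T ≡⟨ balanced-length bal ⟨
      suc a * length S ≡⟨ cong (suc a *_) |S|≡0 ⟩
      suc a * 0        ≡⟨ *-zeroʳ (suc a) ⟩
      0                ∎)
    where open ≡-Reasoning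

  proportional-filterᵇ : ∀ {S T} → Proportional S T → ∀ {q} → Extensional q →
                         Proportional (filterᵇ σ q S) (filterᵇ σ q T)
  proportional-filterᵇ {S} {T} (proportional a b bal) {q} q-ext =
    proportional a b (balanced filtered)
    where
    open ≡-Reasoning
    filtered : ∀ p → Extensional p →
               suc a * countᵇ p (filterᵇ σ q S) ≡ suc b * countᵇ p (filterᵇ σ q T)
    filtered p p-ext = begin
      suc a * countᵇ p (filterᵇ σ q S)
        ≡⟨ cong (λ L → suc a * length L) (filterᵇ-filterᵇ σ p q S) ⟩
      suc a * countᵇ (λ s → q s ∧ p s) S
        ≡⟨ balance bal _ (λ s≈t → cong₂ _∧_ (q-ext s≈t) (p-ext s≈t)) ⟩
      suc b * countᵇ (λ s → q s ∧ p s) T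
        ≡⟨ cong (λ L → suc b * length L) (filterᵇ-filterᵇ σ p q T) ⟨
      suc b * countᵇ p (filterᵇ σ q T)
        ∎

  proportional-map : ∀ {S T} → Proportional S T → ∀ {f} → (∀ {s t} → s ≈ t → f s ≈ f t) →
                     Proportional (map f S) (map f T)
  proportional-map {S} {T} (proportional a b bal) {f} f-ext = proportional a b (balanced mapped)
    where
    open ≡-Reasoning
    mapped : ∀ p → Extensional p → suc a * countᵇ p (map f S) ≡ suc b * countᵇ p (map f T)
    mapped p p-ext = begin
      suc a * countᵇ p (map f S)   ≡⟨ cong (suc a *_) (length-filterᵇ-map σ p f S) ⟩
      suc a * countᵇ (p ∘ f) S     ≡⟨ balance bal (p ∘ f) (p-ext ∘ f-ext) ⟩
      suc b * countᵇ (p ∘ f) T     ≡⟨ cong (suc b *_) (length-filterᵇ-map σ p f T) ⟨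
      suc b * countᵇ p (map f T)   ∎

  proportional-All : ∀ {S T} → Proportional S T → ∀ p → Extensional p →
                     All (λ s → Bool.T (p s)) S → All (λ s → Bool.T (p s)) T
  proportional-All {S} {T} (proportional a b bal) p p-ext pS =
    length-filterᵇ≡⇒All σ p T (*-cancelˡ-≡ _ _ (suc b) (begin
      suc b * countᵇ p T ≡⟨ balance bal p p-ext ⟨
      suc a * countᵇ p S ≡⟨ cong (λ L → suc a * length L) (filterᵇ-all σ p pS) ⟩
      suc a * length S   ≡⟨ balanced-length bal ⟩
      suc b * length T   ∎))
    where open ≡-Reasoning

  proportional-literal : ∀ {S T} → Proportional S T → ∀ Y {P : Val σ Y → Set} →
    (P? : ∀ v → Dec (P v)) → All (λ s → P (s Y)) S → All (λ s → P (s Y)) T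
  proportional-literal prop Y P? =
    All.map (λ {s} → toWitness {a? = P? (s Y)})
    ∘ proportional-All prop (λ s → ⌊ P? (s Y) ⌋) (λ s≈t → cong (λ v → ⌊ P? v ⌋) (s≈t Y))
    ∘ All.map (λ {s} → fromWitness {a? = P? (s Y)})

  ratio-cong : ∀ x y m k → x * suc k ≡ y * suc m → ratio σ x (suc m) ≡ ratio σ y (suc k)
  ratio-cong x y m k eq =
    fromℚᵘ-cong {mkℚᵘ (ℤ.+ x) m} {mkℚᵘ (ℤ.+ y) k} (*≡* (begin
      ℤ.+ x ℤ.* ℤ.+ suc k  ≡⟨ pos-* x (suc k) ⟨
      ℤ.+ (x * suc k)      ≡⟨ cong ℤ.+_ eq ⟩
      ℤ.+ (y * suc m)      ≡⟨ pos-* y (suc m) ⟩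
      ℤ.+ y ℤ.* ℤ.+ suc m  ∎))
    where open ≡-Reasoning

  ratio-injective : ∀ x y m k → ratio σ x (suc m) ≡ ratio σ y (suc k) → x * suc k ≡ y * suc m
  ratio-injective x y m k = normalize-injective-≃ x y (suc m) (suc k)

  frequency : (Row → Bool) → List Row → ℚ.ℚ
  frequency p L = ratio σ (countᵇ p L) (length L)

  proportional-frequency : ∀ {S T} → Proportional S T → ∀ {p} → Extensional p →
                           frequency p S ≡ frequency p T
  proportional-frequency {[]}    {[]}    _ _ = refl
  proportional-frequency {[]}    {_ ∷ _} prop _ with proportional-length-zero prop refl
  ... | ()
  proportional-frequency {_ ∷ _} {[]}    prop _
    with proportional-length-zero (proportional-sym prop) refl
  ... | ()
  proportional-frequency {s ∷ S} {t ∷ T} (proportional a b bal) {p} p-ext =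
    ratio-cong (countᵇ p (s ∷ S)) (countᵇ p (t ∷ T)) (length S) (length T)
               (cross-multiply a b (balance bal p p-ext) (balanced-length bal))

  frequency-self≢0 : ∀ t L → frequency (sameAs t) (t ∷ L) ≢ 0ℚ
  -- 0ℚ computes to ratio σ 0 1, which lets ratio-injective apply to eq.
  frequency-self≢0 t L eq = 0≢1+n (sym (begin
    suc (countᵇ (sameAs t) L) * 1   ≡⟨ cong (_* 1) (countᵇ-self t L) ⟨
    countᵇ (sameAs t) (t ∷ L) * 1   ≡⟨ ratio-injective (countᵇ (sameAs t) (t ∷ L)) 0 (length L) 0 eq ⟩
    0                               ∎))
    where open ≡-Reasoning

  rescaling⇒proportional : ∀ S T → Rescaling σ S T → Proportional S T
  rescaling⇒proportional []      []      _ = proportional 0 0 (balanced λ _ _ → refl)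
  rescaling⇒proportional (_ ∷ _) _       (inj₁ (() , _))
  rescaling⇒proportional []      (_ ∷ _) (inj₁ (_ , ()))
  rescaling⇒proportional []      (t ∷ T) (inj₂ same) = ⊥-elim (frequency-self≢0 t T (sym (same t)))
  rescaling⇒proportional (s ∷ S) []      (inj₂ same) = ⊥-elim (frequency-self≢0 s S (same s))
  rescaling⇒proportional (s ∷ S) (t ∷ T) (inj₂ same) =
    proportional (length T) (length S) (classwise⇒balanced _ ≤-refl (classwise equal-classes))
    where
    equal-classes : ∀ u → length (t ∷ T) * countᵇ (sameAs u) (s ∷ S)
                        ≡ length (s ∷ S) * countᵇ (sameAs u) (t ∷ T)
    equal-classes u =
      trans (*-comm (length (t ∷ T)) inS)
            (trans (ratio-injective inS inT (length S) (length T) (same u))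
                   (*-comm inT (length (s ∷ S))))
      where
      inS inT : ℕ
      inS = countᵇ (sameAs u) (s ∷ S)
      inT = countᵇ (sameAs u) (t ∷ T)

  proportional-Pr : ∀ {S T} → Proportional S T → ∀ F α → Pr σ F S α ≡ Pr σ F T α
  proportional-Pr prop F α = proportional-frequency prop (holds-ext F α)

  transfer : ∀ F {S T} → Proportional S T → ∀ φ → F , S ⊨ φ → F , T ⊨ φ
  transfer F prop (lit≐ Y y)     = proportional-literal prop Y (Fin._≟ y)
  transfer F prop (lit≠ Y y)     = proportional-literal prop Y (λ v → ¬? (v Fin.≟ y))
  transfer F prop (Pr≥ α ε _ _)  =
    ⊎-map (proportional-length-zero prop) (subst (ε ℚ.≤_) (proportional-Pr prop F α))
  transfer F prop (Pr> α ε _ _)  =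
    ⊎-map (proportional-length-zero prop) (subst (ε ℚ.<_) (proportional-Pr prop F α))
  transfer F prop (Pr≥Pr α β)    =
    ⊎-map (proportional-length-zero prop)
          (subst₂ ℚ._≤_ (proportional-Pr prop F β) (proportional-Pr prop F α))
  transfer F prop (Pr>Pr α β)    =
    ⊎-map (proportional-length-zero prop)
          (subst₂ ℚ._<_ (proportional-Pr prop F β) (proportional-Pr prop F α))
  transfer F prop (φ ∧P ψ) (Sφ , Sψ) = transfer F prop φ Sφ , transfer F prop ψ Sψ
  transfer F prop (φ ⊔ ψ)        = ⊎-map (transfer F prop φ) (transfer F prop ψ)
  transfer F prop (⨆ φs) (i , Sφ) = i , transfer F prop (φs i) Sφ
  transfer F prop (α ⊃P ψ)       = transfer F (proportional-filterᵇ prop (holds-ext F α)) ψ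
  transfer F prop (X □→P ψ)      =
    ⊎-map id (transfer (_after_ σ F X) (proportional-map prop (intervene-ext F X)) ψ)

mainTheorem12 : (σ : Signature) (F : FunComp σ) → Recursive σ F →
    (S T : List (Assignment σ)) → All (Compatible σ F) S → All (Compatible σ F) T →
    Rescaling σ S T → (φ : PCO σ) → F , S ⊨ φ → F , T ⊨ φ
mainTheorem12 σ F _ S T _ _ rescaling φ = transfer σ F (rescaling⇒proportional σ S T rescaling) φ
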